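{- For integers $m,n\geq 3$, $\gamma_{P,c}(K_m\,\square\,K_{1,n})=\min\{m-1,\,n\}$.
   Context: Power domination: for $S\subseteq V(G)$, start with $M(S)=N[S]$ and repeatedly add a vertex $w$ whenever some $v\in M(S)$ has $w$ as its unique neighbour outside $M(S)$; $S$ is a connected power dominating set if the final $M(S)$ is $V(G)$ and $\langle S\rangle$ is connected; $\gamma_{P,c}(G)$ is the minimum size of such a set. The Cartesian product $G\,\square\,H$ has vertex set $V(G)\times V(H)$, with $(a,b)\sim(x,y)$ iff either $a=x$ and $by\in E(H)$, or $b=y$ and $ax\in E(G)$. $K_m$ is the complete graph on $m$ vertices and $K_{1,n}$ the star with $n$ leaves. -}

module Defs where

open import Data.Nat using (ℕ; suc; _≤_)
open import Data.Fin using (Fin; zero)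
open import Data.Product using (_×_; Σ; _,_)
open import Data.Sum using (_⊎_)
open import Data.List using (List; length)
open import Data.List.Membership.Propositional using (_∈_)
open import Data.List.Relation.Unary.Unique.Propositional using (Unique)
open import Relation.Binary.PropositionalEquality using (_≡_; _≢_)

record Graph : Set₁ where
  field
    V    : Set
    _~_  : V → V → Set
open Graph public

K : ℕ → Graph
K m = record { V = Fin m ; _~_ = λ i j → i ≢ j }

Star : ℕ → Graph
Star n = record
  { V = Fin (suc n)
  ; _~_ = λ i j → (i ≡ zero × j ≢ zero) ⊎ (j ≡ zero × i ≢ zero) }

_□_ : Graph → Graph → Graph
G □ H = record
  { V = V G × V H
  ; _~_ = λ { (a , b) (x , y) → (a ≡ x × _~_ H b y) ⊎ (b ≡ y × _~_ G a x) } }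

module _ (G : Graph) where
  private
    W = V G
    _≈_ = _~_ G

  -- M(S): the final observed set of the power domination process,
  -- i.e. the least set containing N[S] closed under the propagation rule
  -- (if u is observed and w is its only neighbour not yet observed, observe w).
  data Observed (S : List W) : W → Set where
    dom   : ∀ {s v} → s ∈ S → (s ≡ v ⊎ s ≈ v) → Observed S v
    force : ∀ {u w} → Observed S u → u ≈ w →
            (∀ x → u ≈ x → x ≢ w → Observed S x) → Observed S w

  data InducedWalk (S : List W) : W → W → Set where
    here : ∀ {x} → x ∈ S → InducedWalk S x x
    step : ∀ {x z y} → x ∈ S → x ≈ z → InducedWalk S z y → InducedWalk S x y

  InducedConnected : List W → Set
  InducedConnected S = ∀ x y → x ∈ S → y ∈ S → InducedWalk S x y

  IsConnectedPowerDominating : List W → Set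
  IsConnectedPowerDominating S = (∀ v → Observed S v) × InducedConnected S

  γPc≡ : ℕ → Set
  γPc≡ k =
    Σ (List W) (λ S → Unique S × IsConnectedPowerDominating S × length S ≡ k)
    × (∀ S → Unique S → IsConnectedPowerDominating S → k ≤ length S)

-- The rows of K_m □ K_{1,n} are indexed by Fin m, the columns by the vertices of the
-- star (column 0 being the centre column).
--
-- Upper bound: the centre vertices of all rows but one observe every row they lie in
-- and, by forcing along columns, the remaining row; the centre and all leaves but one
-- of a single row observe every column they lie in and, by forcing along rows, the
-- remaining column. The first set is a clique, the second a star.
--
-- Lower bound: let S be connected with |S| < m − 1 and |S| < n. If S meets the centre
-- column, its columns E contain 0 and number fewer than n; otherwise no edge of ⟨S⟩
-- leaves a column, so S lies in one column c and E = {0, c} has fewer than n elements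
-- because n ≥ 3. Either way at least two rows avoid S and at least two leaf columns
-- avoid E. The product of these rows and columns is a fort (no outside vertex has
-- exactly one neighbour in it) disjoint from N[S], so none of its vertices is observed.
module Submission where

open import Defs
open import Data.Nat using (ℕ; zero; suc; _≤_; _<_; _∸_; _⊓_; s≤s; _≤?_)
open import Data.Nat.Properties using (⊓-sel; m⊓n≤m; m⊓n≤n; <-≤-trans; ≰⇒>; <⇒≤; m<n⇒m<1+n)
open import Data.Fin using (Fin; zero; suc; punchIn)
open import Data.Fin.Properties
  using (_≟_; all?; ¬∀⟶∃¬; pigeonhole; <⇒≢; punchIn-injective; punchIn-punchOut)
open import Data.Product using (_×_; Σ; _,_; proj₁; proj₂; ∃-syntax)
open import Data.Sum using (_⊎_; inj₁; inj₂)
open import Data.List using (List; []; _∷_; length; map; allFin; lookup)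
open import Data.List.Properties using (length-map; length-tabulate)
open import Data.List.Membership.Propositional using (_∈_; _∉_)
open import Data.List.Membership.Propositional.Properties using (∈-map⁺; ∈-map⁻; ∈-allFin)
open import Data.List.Relation.Unary.Any using (here; there; index; any?)
open import Data.List.Relation.Unary.Any.Properties using (lookup-index)
open import Data.List.Relation.Unary.Unique.Propositional using (Unique)
open import Data.List.Relation.Unary.Unique.Propositional.Properties as Unique using (allFin⁺)
open import Data.Empty using (⊥-elim)
open import Function using (_∘_)
open import Relation.Binary.PropositionalEquality using (_≡_; _≢_; refl; sym; trans; cong; subst)
open import Relation.Nullary using (¬_; yes; no; contradiction)
open import Relation.Unary using (Pred; _⟨×⟩_)
open import Level using (0ℓ)

-- Otherwise the index of an occurrence of each x would inject Fin p into Fin (length L).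
∃∉ : ∀ {p} (L : List (Fin p)) → length L < p → ∃[ x ] x ∉ L
∃∉ {p} L |L|<p with all? (λ x → any? (x ≟_) L)
... | no not-all = ¬∀⟶∃¬ p (_∈ L) (λ x → any? (x ≟_) L) not-all
... | yes all =
  let i , j , i<j , same-index = pigeonhole |L|<p (index ∘ all)
  in contradiction (trans (lookup-index (all i))
                          (trans (cong (lookup L) same-index) (sym (lookup-index (all j)))))
                   (<⇒≢ i<j)

allFinExcept : ∀ {k} → Fin (suc k) → List (Fin (suc k))
allFinExcept p = map (punchIn p) (allFin _)

∈-allFinExcept⁺ : ∀ {k} {p q : Fin (suc k)} → p ≢ q → q ∈ allFinExcept p
∈-allFinExcept⁺ p≢q = subst (_∈ _) (punchIn-punchOut p≢q) (∈-map⁺ (punchIn _) (∈-allFin _))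

allFinExcept-unique : ∀ {k} (p : Fin (suc k)) → Unique (allFinExcept p)
allFinExcept-unique p = Unique.map⁺ (punchIn-injective p _ _) (allFin⁺ _)

length-allFinExcept : ∀ {k} (p : Fin (suc k)) → length (allFinExcept p) ≡ k
length-allFinExcept {k} p = trans (length-map (punchIn p) (allFin k)) (length-tabulate (λ i → i))

module _ (G : Graph) where

  -- The usual nonemptiness requirement on forts is dropped.
  IsFort : Pred (V G) 0ℓ → Set
  IsFort F = ∀ {u w} → _~_ G u w → F w → F u ⊎ ∃[ x ] (_~_ G u x × x ≢ w × F x)

  fort-unobserved : ∀ {S F} → IsFort F → (∀ {s v} → s ∈ S → s ≡ v ⊎ _~_ G s v → ¬ F v) →
                    ∀ {v} → Observed G S v → ¬ F v
  fort-unobserved fort N[S]∩F≡∅ (dom s∈S s-v) = N[S]∩F≡∅ s∈S s-v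
  fort-unobserved fort N[S]∩F≡∅ (force observed-u u~w others) Fw with fort u~w Fw
  ... | inj₁ Fu = fort-unobserved fort N[S]∩F≡∅ observed-u Fu
  ... | inj₂ (x , u~x , x≢w , Fx) = fort-unobserved fort N[S]∩F≡∅ (others x u~x x≢w) Fx

  walk-source∈ : ∀ {S x y} → InducedWalk G S x y → x ∈ S
  walk-source∈ (here x∈S)     = x∈S
  walk-source∈ (step x∈S _ _) = x∈S

  IsHub : List (V G) → V G → Set
  IsHub S c = ∀ {x} → x ∈ S → x ≡ c ⊎ (_~_ G x c × _~_ G c x)

  walk-from-hub : ∀ {S c} → c ∈ S → IsHub S c → ∀ {y} → y ∈ S → InducedWalk G S c y
  walk-from-hub c∈S hub y∈S with hub y∈S
  ... | inj₁ refl      = here y∈S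
  ... | inj₂ (_ , c~y) = step c∈S c~y (here y∈S)

  hub⇒connected : ∀ {S c} → c ∈ S → IsHub S c → InducedConnected G S
  hub⇒connected c∈S hub x y x∈S y∈S with hub x∈S
  ... | inj₁ refl      = walk-from-hub c∈S hub y∈S
  ... | inj₂ (x~c , _) = step x∈S x~c (walk-from-hub c∈S hub y∈S)

module _ {G H : Graph} where

  □-closedNbr : ∀ {s v : V (G □ H)} → s ≡ v ⊎ _~_ (G □ H) s v →
                proj₁ s ≡ proj₁ v ⊎ proj₂ s ≡ proj₂ v
  □-closedNbr (inj₁ refl)              = inj₁ refl
  □-closedNbr (inj₂ (inj₁ (a≡x , _)))  = inj₁ a≡x
  □-closedNbr (inj₂ (inj₂ (b≡y , _)))  = inj₂ b≡y

  □-fort : ∀ {A B} → IsFort G A → IsFort H B → IsFort (G □ H) (A ⟨×⟩ B)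
  □-fort A-fort B-fort {_ , b} {x , y} (inj₁ (refl , b~y)) (Ax , By) with B-fort b~y By
  ... | inj₁ Bb = inj₁ (Ax , Bb)
  ... | inj₂ (y′ , b~y′ , y′≢y , By′) =
    inj₂ ((x , y′) , inj₁ (refl , b~y′) , y′≢y ∘ cong proj₂ , Ax , By′)
  □-fort A-fort B-fort {a , _} {x , y} (inj₂ (refl , a~x)) (Ax , By) with A-fort a~x Ax
  ... | inj₁ Aa = inj₁ (Aa , By)
  ... | inj₂ (x′ , a~x′ , x′≢x , Ax′) =
    inj₂ ((x′ , y) , inj₂ (refl , a~x′) , x′≢x ∘ cong proj₁ , Ax′ , By)

  □-fort-unobserved : ∀ {S A B} → IsFort G A → IsFort H B →
                      (∀ {s} → s ∈ S → ¬ A (proj₁ s)) → (∀ {s} → s ∈ S → ¬ B (proj₂ s)) →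
                      ∀ {v} → Observed (G □ H) S v → ¬ (A ⟨×⟩ B) v
  □-fort-unobserved {S} {A} {B} A-fort B-fort rows-avoid cols-avoid =
    fort-unobserved (G □ H) (□-fort A-fort B-fort) N[S]∩A×B≡∅
    where
    N[S]∩A×B≡∅ : ∀ {s v} → s ∈ S → s ≡ v ⊎ _~_ (G □ H) s v → ¬ (A ⟨×⟩ B) v
    N[S]∩A×B≡∅ s∈S s-v (Ax , By) with □-closedNbr s-v
    ... | inj₁ refl = rows-avoid s∈S Ax
    ... | inj₂ refl = cols-avoid s∈S By

∉-fort-K : ∀ {m} (R : List (Fin m)) → suc (length R) < m → IsFort (K m) (_∉ R)
∉-fort-K R 2+|R|≤m {a} {x} _ x∉R with ∃∉ (x ∷ R) 2+|R|≤m
... | x′ , x′∉x∷R with a ≟ x′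
...   | yes refl  = inj₁ (x′∉x∷R ∘ there)
...   | no a≢x′   = inj₂ (x′ , a≢x′ , x′∉x∷R ∘ here , x′∉x∷R ∘ there)

∉-fort-Star : ∀ {n} (E : List (Fin (suc n))) → zero ∈ E → length E < n → IsFort (Star n) (_∉ E)
∉-fort-Star E 0∈E _ (inj₂ (refl , _)) y∉E = contradiction 0∈E y∉E
∉-fort-Star E 0∈E |E|<n {w = y} (inj₁ (refl , _)) y∉E with ∃∉ (y ∷ E) (s≤s |E|<n)
... | y′ , y′∉y∷E = inj₂ (y′ , inj₁ (refl , y′≢0) , y′∉y∷E ∘ here , y′∉y∷E ∘ there)
  where
  y′≢0 : y′ ≢ zero
  y′≢0 refl = y′∉y∷E (there 0∈E)

module _ {G : Graph} {n : ℕ} {S : List (V (G □ Star n))} where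

  walk-within-column : (∀ {s} → s ∈ S → proj₂ s ≢ zero) →
                       ∀ {x y} → InducedWalk (G □ Star n) S x y → proj₂ x ≡ proj₂ y
  walk-within-column off-centre (here _) = refl
  walk-within-column off-centre (step x∈S (inj₁ (_ , inj₁ (b≡0 , _))) _) =
    ⊥-elim (off-centre x∈S b≡0)
  walk-within-column off-centre (step _ (inj₁ (_ , inj₂ (d≡0 , _))) walk) =
    ⊥-elim (off-centre (walk-source∈ (G □ Star n) walk) d≡0)
  walk-within-column off-centre (step _ (inj₂ (b≡d , _)) walk) =
    trans b≡d (walk-within-column off-centre walk)

few-columns : ∀ {G n} → 3 ≤ n → (S : List (V (G □ Star n))) → InducedConnected (G □ Star n) S →
              length S < n →
              ∃[ E ] zero ∈ E × (∀ {s} → s ∈ S → proj₂ s ∈ E) × length E < n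
few-columns n≥3 [] _ _ = zero ∷ [] , here refl , (λ ()) , <⇒≤ n≥3
few-columns {n = n} n≥3 S@(s₀ ∷ _) connected |S|<n with any? (zero ≟_) (map proj₂ S)
... | yes 0∈E = map proj₂ S , 0∈E , ∈-map⁺ proj₂ , subst (_< n) (sym (length-map proj₂ S)) |S|<n
... | no 0∉E = zero ∷ proj₂ s₀ ∷ [] , here refl , there ∘ here ∘ column-of-s₀ , n≥3
  where
  column-of-s₀ : ∀ {s} → s ∈ S → proj₂ s ≡ proj₂ s₀
  column-of-s₀ s∈S = walk-within-column (λ s∈S s₂≡0 → 0∉E (subst (_∈ _) s₂≡0 (∈-map⁺ proj₂ s∈S)))
                                        (connected _ _ s∈S (here refl))

small-connected-set-misses : ∀ {k n} → 3 ≤ n → (S : List (Fin (suc k) × Fin (suc n))) →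
                             InducedConnected (K (suc k) □ Star n) S → length S < k → length S < n →
                             ∃[ v ] ¬ Observed (K (suc k) □ Star n) S v
small-connected-set-misses n≥3 S connected |S|<k |S|<n
  with few-columns n≥3 S connected |S|<n
... | E , 0∈E , columns⊆E , |E|<n =
  let x , x∉R = ∃∉ R (m<n⇒m<1+n |R|<k)
      y , y∉E = ∃∉ E (m<n⇒m<1+n |E|<n)
  in (x , y) , λ observed →
       □-fort-unobserved (∉-fort-K R (s≤s |R|<k)) (∉-fort-Star E 0∈E |E|<n)
                         (λ s∈S → contradiction (∈-map⁺ proj₁ s∈S))
                         (λ s∈S → contradiction (columns⊆E s∈S))
                         observed (x∉R , y∉E)
  where
  R = map proj₁ S
  |R|<k = subst (_< _) (sym (length-map proj₁ S)) |S|<k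

lower-bound : ∀ {k n} → 3 ≤ n → (S : List (Fin (suc k) × Fin (suc n))) →
              IsConnectedPowerDominating (K (suc k) □ Star n) S → k ⊓ n ≤ length S
lower-bound {k} {n} n≥3 S (observes , connected) with k ⊓ n ≤? length S
... | yes bound = bound
... | no ¬bound =
  let |S|<k⊓n = ≰⇒> ¬bound
      v , unobserved = small-connected-set-misses n≥3 S connected
                         (<-≤-trans |S|<k⊓n (m⊓n≤m k n)) (<-≤-trans |S|<k⊓n (m⊓n≤n k n))
  in contradiction (observes v) unobserved

CPDSetOfSize : Graph → ℕ → Set
CPDSetOfSize G k =
  Σ (List (V G)) (λ S → Unique S × IsConnectedPowerDominating G S × length S ≡ k)

module _ {k n : ℕ} where

  private
    G : Graph
    G = K (suc (suc k)) □ Star n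
    centre-of : Fin (suc (suc k)) → V G
    centre-of r = r , zero
    S : List (V G)
    S = map centre-of (allFinExcept zero)

    centre∈S : ∀ {r} → zero ≢ r → centre-of r ∈ S
    centre∈S 0≢r = ∈-map⁺ centre-of (∈-allFinExcept⁺ 0≢r)

  observed-off-row-0 : ∀ {r y} → zero ≢ r → Observed G S (r , y)
  observed-off-row-0 {y = zero}  0≢r = dom (centre∈S 0≢r) (inj₁ refl)
  observed-off-row-0 {y = suc _} 0≢r =
    dom (centre∈S 0≢r) (inj₂ (inj₁ (refl , inj₁ (refl , λ ()))))

  centre-column-observes : ∀ v → Observed G S v
  centre-column-observes (suc _ , _) = observed-off-row-0 λ ()
  centre-column-observes (zero , y) =
    force {u = suc zero , y} (observed-off-row-0 λ ()) (inj₂ (refl , λ ())) others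
    where
    others : ∀ v → _~_ G (suc zero , y) v → v ≢ (zero , y) → Observed G S v
    others _ (inj₁ (refl , _)) _   = observed-off-row-0 λ ()
    others _ (inj₂ (refl , _)) v≢w = observed-off-row-0 (v≢w ∘ cong (_, y) ∘ sym)

  centre-column-CPD : CPDSetOfSize G (suc k)
  centre-column-CPD =
    S , Unique.map⁺ (cong proj₁) (allFinExcept-unique zero) ,
    (centre-column-observes , hub⇒connected G (centre∈S {suc zero} λ ()) hub) ,
    trans (length-map centre-of (allFinExcept zero)) (length-allFinExcept zero)
    where
    hub : IsHub G S (suc zero , zero)
    hub v∈S with ∈-map⁻ centre-of v∈S
    ... | r , _ , refl with r ≟ suc zero
    ...   | yes refl = inj₁ refl
    ...   | no r≢1   = inj₂ (inj₂ (refl , r≢1) , inj₂ (refl , r≢1 ∘ sym))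

module _ {m n : ℕ} where

  private
    G : Graph
    G = K (suc m) □ Star (suc n)
    in-row-0 : Fin (suc (suc n)) → V G
    in-row-0 c = zero , c
    S : List (V G)
    S = map in-row-0 (allFinExcept (suc zero))

    in-row-0∈S : ∀ {c} → suc zero ≢ c → in-row-0 c ∈ S
    in-row-0∈S 1≢c = ∈-map⁺ in-row-0 (∈-allFinExcept⁺ 1≢c)

  observed-off-column-1 : ∀ {x c} → suc zero ≢ c → Observed G S (x , c)
  observed-off-column-1 {x = zero}  1≢c = dom (in-row-0∈S 1≢c) (inj₁ refl)
  observed-off-column-1 {x = suc _} 1≢c =
    dom (in-row-0∈S 1≢c) (inj₂ (inj₂ (refl , λ ())))

  first-row-observes : ∀ v → Observed G S v
  first-row-observes (_ , zero)        = observed-off-column-1 λ ()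
  first-row-observes (_ , suc (suc _)) = observed-off-column-1 λ ()
  first-row-observes (x , suc zero) =
    force {u = x , zero} (observed-off-column-1 λ ()) (inj₁ (refl , inj₁ (refl , λ ()))) others
    where
    others : ∀ v → _~_ G (x , zero) v → v ≢ (x , suc zero) → Observed G S v
    others _ (inj₁ (refl , _)) v≢w = observed-off-column-1 (v≢w ∘ cong (x ,_) ∘ sym)
    others _ (inj₂ (refl , _)) _   = observed-off-column-1 λ ()

  first-row-CPD : CPDSetOfSize G (suc n)
  first-row-CPD =
    S , Unique.map⁺ (cong proj₂) (allFinExcept-unique (suc zero)) ,
    (first-row-observes , hub⇒connected G (in-row-0∈S {zero} λ ()) hub) ,
    trans (length-map in-row-0 (allFinExcept (suc zero))) (length-allFinExcept (suc zero))
    where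
    hub : IsHub G S (zero , zero)
    hub v∈S with ∈-map⁻ in-row-0 v∈S
    ... | zero  , _ , refl = inj₁ refl
    ... | suc _ , _ , refl = inj₂ (inj₁ (refl , inj₂ (refl , λ ())) , inj₁ (refl , inj₁ (refl , λ ())))

upper-bound : ∀ k n → CPDSetOfSize (K (suc (suc k)) □ Star (suc n)) (suc k ⊓ suc n)
upper-bound k n with ⊓-sel (suc k) (suc n)
... | inj₁ k⊓n≡k = subst (CPDSetOfSize _) (sym k⊓n≡k) centre-column-CPD
... | inj₂ k⊓n≡n = subst (CPDSetOfSize _) (sym k⊓n≡n) first-row-CPD

theorem7 : ∀ (m n : ℕ) → 3 ≤ m → 3 ≤ n → γPc≡ (K m □ Star n) ((m ∸ 1) ⊓ n)
theorem7 (suc (suc k)) (suc n) _ n≥3 = upper-bound k n , λ S _ → lower-bound n≥3 S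
theorem7 zero          _       () _
theorem7 (suc zero)    _       (s≤s ()) _
theorem7 (suc (suc _)) zero    _ ()
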